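{- Let $k$ be a positive integer, and let $\mathrm{TC}_k$ with terminals $s_k,t_k$ be built from the two copies $(B^1,s^1_{k-1},t^1_{k-1})$ and $(B^2,s^2_{k-1},t^2_{k-1})$ of $\mathrm{TC}_{k-1}$ by adding the edges $(s^1_{k-1},t^2_{k-1})$ and $(s^2_{k-1},t^1_{k-1})$. Then: (1) there is a unique directed path from $t_k$ to $s_k$ in $\mathrm{TC}_k$, and it contains all vertices of $\mathrm{TC}_k$; (2) every directed cycle of $\mathrm{TC}_k$ containing the edge $(s^1_{k-1},t^2_{k-1})$ or the edge $(s^2_{k-1},t^1_{k-1})$ contains all vertices of $\mathrm{TC}_k$; (3) $\mathsf{circ}(\mathrm{TC}_k)=2^k$.
   Context: $\mathrm{TC}_0$ is a single vertex $v$ with terminals $s_0=t_0=v$. For $i\ge1$, $\mathrm{TC}_i$ is obtained from two disjoint copies $(B^1,s^1_{i-1},t^1_{i-1})$ and $(B^2,s^2_{i-1},t^2_{i-1})$ of $(\mathrm{TC}_{i-1},s_{i-1},t_{i-1})$ by adding the edges $(s^1_{i-1},t^2_{i-1})$ and $(s^2_{i-1},t^1_{i-1})$, and setting $s_i=s^1_{i-1}$, $t_i=t^2_{i-1}$. The circumference $\mathsf{circ}(G)$ is the length of a longest directed cycle of $G$ (or $0$ if none exists). -}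

module Defs where

open import Data.Nat using (ℕ; zero; suc; _≤_)
open import Data.Unit using (⊤; tt)
open import Data.Sum using (_⊎_; inj₁; inj₂)
open import Data.Product using (_×_; ∃; ∃-syntax; Σ-syntax)
open import Data.Maybe using (just)
open import Data.List using (List; head; last; length; _++_; _∷_)
open import Data.List.Relation.Unary.Linked using (Linked)
open import Data.List.Relation.Unary.Unique.Propositional using (Unique)
open import Data.List.Membership.Propositional using (_∈_)
open import Relation.Binary.PropositionalEquality using (_≡_)
open import Relation.Nullary using (¬_)

-- Vertices of TC_i : TC_0 has one vertex; TC_{i+1} = B¹ ⊎ B² (inj₁ = copy 1, inj₂ = copy 2)
V : ℕ → Set
V zero    = ⊤
V (suc i) = V i ⊎ V i

s : (i : ℕ) → V i
s zero    = tt
s (suc i) = inj₁ (s i)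

t : (i : ℕ) → V i
t zero    = tt
t (suc i) = inj₂ (t i)

data E : (i : ℕ) → V i → V i → Set where
  inB¹   : ∀ {i u v} → E i u v → E (suc i) (inj₁ u) (inj₁ v)
  inB²   : ∀ {i u v} → E i u v → E (suc i) (inj₂ u) (inj₂ v)
  cross₁ : ∀ {i} → E (suc i) (inj₁ (s i)) (inj₂ (t i))
  cross₂ : ∀ {i} → E (suc i) (inj₂ (s i)) (inj₁ (t i))

IsPath : (i : ℕ) → V i → V i → List (V i) → Set
IsPath i a b xs = Linked (E i) xs × Unique xs × head xs ≡ just a × last xs ≡ just b

-- a directed cycle, given by its (nonempty, distinct) vertex sequence v₀ … v_{m-1},
-- with edges vⱼ → vⱼ₊₁ and the closing edge v_{m-1} → v₀; its length is m
IsCycle : (i : ℕ) → List (V i) → Set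
IsCycle i xs = Linked (E i) xs × Unique xs ×
  ∃[ u ] ∃[ v ] (last xs ≡ just u × head xs ≡ just v × E i u v)

UsesEdge : {i : ℕ} → List (V i) → V i → V i → Set
UsesEdge {i} xs u v =
  (∃[ as ] ∃[ bs ] xs ≡ as ++ (u ∷ v ∷ bs)) ⊎ (last xs ≡ just u × head xs ≡ just v)

Circ : (i : ℕ) → ℕ → Set
Circ i n =
  ((∃[ xs ] (IsCycle i xs × length xs ≡ n)) ⊎ (n ≡ 0 × (∀ xs → ¬ IsCycle i xs)))
  × (∀ xs → IsCycle i xs → length xs ≤ n)

-- The path H_i that runs through B² from t² to s², crosses to t¹ and runs through B¹ to s¹
-- visits every vertex. It is the only t–s path: starting in B², a path can leave B² only
-- along (s², t¹), and it can never leave B¹ again, because the only edge out of B¹ starts at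
-- s¹, its endpoint; so it splits into a t²–s² path and a t¹–s¹ path, and induction applies.
-- Rotating a cycle through an edge (u, v) turns it into a v–u path on the same vertices;
-- for (s¹, t²) this is a t–s path, for (s², t¹) it becomes one after exchanging the copies.
-- Closing H_i by (s¹, t²) gives a cycle of length 2^i, and no cycle can repeat a vertex.

module Submission where

open import Defs
open import Data.Nat using (ℕ; zero; suc; _^_; _≤_; _+_; z≤n; s≤s)
open import Data.Nat.Properties using (+-identityʳ; module ≤-Reasoning)
open import Data.Product using (_×_; ∃-syntax; _,_)
open import Data.Sum using (_⊎_; inj₁; inj₂)
open import Data.Unit using (tt)
open import Data.Empty using (⊥-elim)
open import Function using (_∘_)
open import Data.Maybe as Maybe using (just)
open import Data.Maybe.Relation.Binary.Connected using (Connected; just)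
open import Data.List using (List; []; _∷_; [_]; _++_; map; head; last; length)
open import Data.List.Properties using (++-assoc; length-++; length-map; head-map; last-map)
open import Data.List.Membership.Propositional using (_∈_; _∉_)
open import Data.List.Membership.Propositional.Properties using (∈-map⁺; ∈-map⁻; ∈-++⁺ˡ; ∈-++⁺ʳ; ∈-∃++)
open import Data.List.Relation.Unary.Any using (here; there)
open import Data.List.Relation.Unary.All as All using ([])
open import Data.List.Relation.Unary.All.Properties using (¬Any⇒All¬)
open import Data.List.Relation.Unary.AllPairs using ([]; _∷_)
open import Data.List.Relation.Unary.Linked as Linked using (Linked; []; [-]; _∷_)
import Data.List.Relation.Unary.Linked.Properties as Linked
open import Data.List.Relation.Unary.Unique.Propositional using (Unique)
import Data.List.Relation.Unary.Unique.Propositional.Properties as Unique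
open import Data.List.Relation.Binary.Disjoint.Propositional using (Disjoint)
open import Data.List.Relation.Binary.Permutation.Propositional using (_↭_; ↭-refl; ↭-sym; ↭⇒↭ₛ)
open import Data.List.Relation.Binary.Permutation.Propositional.Properties using (++-comm; ∈-resp-↭; ↭-length; shift)
open import Data.List.Relation.Binary.Permutation.Setoid.Properties using (Unique-resp-↭)
open import Relation.Binary.PropositionalEquality using (_≡_; refl; sym; trans; cong; cong₂; subst; subst₂; setoid; module ≡-Reasoning)

module _ {A : Set} where

  head-++ : ∀ (xs : List A) {ys a} → head xs ≡ just a → head (xs ++ ys) ≡ just a
  head-++ (x ∷ xs) h = h

  head-++-∷ : ∀ (xs : List A) {y ys zs} → head (xs ++ y ∷ ys) ≡ head (xs ++ y ∷ zs)
  head-++-∷ []      = refl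
  head-++-∷ (x ∷ xs) = refl

  last-++-∷ : ∀ (xs : List A) y ys → last (xs ++ y ∷ ys) ≡ last (y ∷ ys)
  last-++-∷ []           y ys = refl
  last-++-∷ (x ∷ [])     y ys = refl
  last-++-∷ (x ∷ x′ ∷ xs) y ys = last-++-∷ (x′ ∷ xs) y ys

  last-++ : ∀ (xs : List A) {ys a} → last ys ≡ just a → last (xs ++ ys) ≡ just a
  last-++ xs {y ∷ ys} l = trans (last-++-∷ xs y ys) l

  last∈ : ∀ (xs : List A) {a} → last xs ≡ just a → a ∈ xs
  last∈ (x ∷ [])     refl = here refl
  last∈ (x ∷ x′ ∷ xs) l    = there (last∈ (x′ ∷ xs) l)

  Unique-⊆⇒length≤ : ∀ {xs ys : List A} → Unique xs → (∀ {v} → v ∈ xs → v ∈ ys) → length xs ≤ length ys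
  Unique-⊆⇒length≤ {[]}     _            _   = z≤n
  Unique-⊆⇒length≤ {x ∷ xs} (x∉xs ∷ uniq) xs⊆ys with ∈-∃++ (xs⊆ys (here refl))
  ... | as , bs , refl = begin
    suc (length xs)         ≤⟨ s≤s (Unique-⊆⇒length≤ uniq xs⊆as++bs) ⟩
    suc (length (as ++ bs)) ≡⟨ sym (↭-length (shift x as bs)) ⟩
    length (as ++ [ x ] ++ bs) ∎
    where
    open ≤-Reasoning
    xs⊆as++bs : ∀ {v} → v ∈ xs → v ∈ as ++ bs
    xs⊆as++bs v∈xs with ∈-resp-↭ (shift x as bs) (xs⊆ys (there v∈xs))
    ... | here refl = ⊥-elim (All.lookup x∉xs v∈xs refl)
    ... | there v∈  = v∈

  module _ {R : A → A → Set} where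

    Linked-++⁻ˡ : ∀ (xs : List A) {ys} → Linked R (xs ++ ys) → Linked R xs
    Linked-++⁻ˡ []           _         = []
    Linked-++⁻ˡ (x ∷ [])     _         = [-]
    Linked-++⁻ˡ (x ∷ x′ ∷ xs) (r ∷ rs) = r ∷ Linked-++⁻ˡ (x′ ∷ xs) rs

    Linked-++⁻ʳ : ∀ (xs : List A) {ys} → Linked R (xs ++ ys) → Linked R ys
    Linked-++⁻ʳ []       rs = rs
    Linked-++⁻ʳ (x ∷ xs) rs = Linked-++⁻ʳ xs (Linked.tail rs)

module _ {i : ℕ} where

  IsPath-∷ : ∀ {a b c zs} → E i a b → a ∉ b ∷ zs → IsPath i b c (b ∷ zs) → IsPath i a c (a ∷ b ∷ zs)
  IsPath-∷ {zs = zs} e a∉ (linked , uniq , refl , l) = e ∷ linked , ¬Any⇒All¬ (_ ∷ zs) a∉ ∷ uniq , refl , l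

  IsPath-tail : ∀ {a b c zs} → IsPath i a c (a ∷ b ∷ zs) → IsPath i b c (b ∷ zs)
  IsPath-tail (_ ∷ linked , _ ∷ uniq , _ , l) = linked , uniq , refl , l

  IsPath-++ : ∀ {a b c d xs ys} → IsPath i a b xs → E i b c → IsPath i c d ys → Disjoint xs ys →
              IsPath i a d (xs ++ ys)
  IsPath-++ {xs = xs} (linked , uniq , h , l) e (linked′ , uniq′ , h′ , l′) disjoint =
    Linked.++⁺ linked (subst₂ (Connected (E i)) (sym l) (sym h′) (just e)) linked′ ,
    Unique.++⁺ uniq uniq′ disjoint , head-++ xs h , last-++ xs l′

  IsPath⇒IsCycle : ∀ {a b xs} → IsPath i b a xs → E i a b → IsCycle i xs
  IsPath⇒IsCycle (linked , uniq , h , l) e = linked , uniq , _ , _ , l , h , e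

  IsPath-map : ∀ {j} (f : V i → V j) → (∀ {x y} → f x ≡ f y → x ≡ y) → (∀ {x y} → E i x y → E j (f x) (f y)) →
               ∀ {a b xs} → IsPath i a b xs → IsPath j (f a) (f b) (map f xs)
  IsPath-map f f-injective f-hom {xs = xs} (linked , uniq , h , l) =
    Linked.map⁺ (Linked.map f-hom linked) , Unique.map⁺ f-injective uniq ,
    trans (head-map xs) (cong (Maybe.map f) h) , trans (last-map f xs) (cong (Maybe.map f) l)

  cycle-through⇒path : ∀ {a b} c → IsCycle i c → UsesEdge c a b → ∃[ p ] (IsPath i b a p × p ↭ c)
  cycle-through⇒path c (linked , uniq , _) (inj₂ (l , h)) = c , (linked , uniq , h , l) , ↭-refl
  cycle-through⇒path {a} {b} _ (linked , uniq , _ , _ , l , h , e) (inj₁ (as , bs , refl)) =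
    p , (linked-p , Unique-resp-↭ (setoid (V i)) (↭⇒↭ₛ (↭-sym p↭c)) uniq , refl , last-++ (b ∷ bs) (last-++ as refl)) ,
    p↭c
    where
    p : List (V i)
    p = (b ∷ bs) ++ (as ++ [ a ])
    c≡ : as ++ a ∷ b ∷ bs ≡ (as ++ [ a ]) ++ b ∷ bs
    c≡ = sym (++-assoc as [ a ] (b ∷ bs))
    p↭c : p ↭ as ++ a ∷ b ∷ bs
    p↭c = subst (p ↭_) (sym c≡) (++-comm (b ∷ bs) (as ++ [ a ]))
    linked-c : Linked (E i) ((as ++ [ a ]) ++ b ∷ bs)
    linked-c = subst (Linked (E i)) c≡ linked
    closing : Connected (E i) (last (b ∷ bs)) (head (as ++ [ a ]))
    closing = subst₂ (Connected (E i)) (trans (sym l) (last-++-∷ as a (b ∷ bs))) (trans (sym h) (head-++-∷ as)) (just e)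
    linked-p : Linked (E i) p
    linked-p = Linked.++⁺ (Linked-++⁻ʳ (as ++ [ a ]) linked-c) closing (Linked-++⁻ˡ (as ++ [ a ]) linked-c)

hamiltonianPath : (i : ℕ) → List (V i)
hamiltonianPath zero    = tt ∷ []
hamiltonianPath (suc i) = map inj₂ (hamiltonianPath i) ++ map inj₁ (hamiltonianPath i)

module _ {i : ℕ} where

  inj₁-injective : ∀ {x y : V i} → _≡_ {A = V (suc i)} (inj₁ x) (inj₁ y) → x ≡ y
  inj₁-injective refl = refl

  inj₂-injective : ∀ {x y : V i} → _≡_ {A = V (suc i)} (inj₂ x) (inj₂ y) → x ≡ y
  inj₂-injective refl = refl

  map-inj₂-map-inj₁-disjoint : (xs ys : List (V i)) → Disjoint {A = V (suc i)} (map inj₂ xs) (map inj₁ ys)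
  map-inj₂-map-inj₁-disjoint xs ys (v∈xs , v∈ys) with ∈-map⁻ inj₂ v∈xs | ∈-map⁻ inj₁ v∈ys
  ... | _ , _ , refl | _ , _ , ()

  swap : V (suc i) → V (suc i)
  swap (inj₁ x) = inj₂ x
  swap (inj₂ x) = inj₁ x

  swap-involutive : ∀ v → swap (swap v) ≡ v
  swap-involutive (inj₁ x) = refl
  swap-involutive (inj₂ x) = refl

  swap-injective : ∀ {x y} → swap x ≡ swap y → x ≡ y
  swap-injective {x} {y} eq = trans (sym (swap-involutive x)) (trans (cong swap eq) (swap-involutive y))

  swap-hom : ∀ {x y} → E (suc i) x y → E (suc i) (swap x) (swap y)
  swap-hom (inB¹ e) = inB² e
  swap-hom (inB² e) = inB¹ e
  swap-hom cross₁   = cross₂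
  swap-hom cross₂   = cross₁

hamiltonianPath-isPath : ∀ i → IsPath i (t i) (s i) (hamiltonianPath i)
hamiltonianPath-isPath zero    = [-] , [] ∷ [] , refl , refl
hamiltonianPath-isPath (suc i) =
  IsPath-++ (IsPath-map inj₂ inj₂-injective inB² path) cross₂ (IsPath-map inj₁ inj₁-injective inB¹ path)
            (map-inj₂-map-inj₁-disjoint (hamiltonianPath i) (hamiltonianPath i))
  where path = hamiltonianPath-isPath i

∈-hamiltonianPath : ∀ i v → v ∈ hamiltonianPath i
∈-hamiltonianPath zero    tt       = here refl
∈-hamiltonianPath (suc i) (inj₁ v) = ∈-++⁺ʳ (map inj₂ (hamiltonianPath i)) (∈-map⁺ inj₁ (∈-hamiltonianPath i v))
∈-hamiltonianPath (suc i) (inj₂ v) = ∈-++⁺ˡ (∈-map⁺ inj₂ (∈-hamiltonianPath i v))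

length-hamiltonianPath : ∀ i → length (hamiltonianPath i) ≡ 2 ^ i
length-hamiltonianPath zero    = refl
length-hamiltonianPath (suc i) = begin
  length (map inj₂ H ++ map inj₁ H)         ≡⟨ length-++ (map inj₂ H) ⟩
  length (map inj₂ H) + length (map inj₁ H) ≡⟨ cong₂ _+_ (length-map inj₂ H) (length-map inj₁ H) ⟩
  length H + length H                       ≡⟨ cong (λ n → n + n) (length-hamiltonianPath i) ⟩
  2 ^ i + 2 ^ i                             ≡⟨ cong (2 ^ i +_) (sym (+-identityʳ (2 ^ i))) ⟩
  2 ^ suc i                                 ∎
  where
  open ≡-Reasoning
  H = hamiltonianPath i

path-to-s¹-stays-in-B¹ : ∀ {i} w xs → IsPath (suc i) (inj₁ w) (inj₁ (s i)) (inj₁ w ∷ xs) →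
                         ∃[ zs ] (xs ≡ map inj₁ zs × IsPath i w (s i) (w ∷ zs))
path-to-s¹-stays-in-B¹ w [] (_ , _ , _ , refl) = [] , refl , [-] , [] ∷ [] , refl , refl
path-to-s¹-stays-in-B¹ w (inj₁ w′ ∷ xs) path@(inB¹ e ∷ _ , uniq , _) with path-to-s¹-stays-in-B¹ w′ xs (IsPath-tail path)
... | zs , refl , path′ = w′ ∷ zs , refl , IsPath-∷ e (Unique.Unique[x∷xs]⇒x∉xs uniq ∘ ∈-map⁺ inj₁) path′
path-to-s¹-stays-in-B¹ {i} _ (inj₂ _ ∷ xs) (cross₁ ∷ _ , uniq , _ , l) =
  ⊥-elim (Unique.Unique[x∷xs]⇒x∉xs uniq (last∈ (inj₂ (t i) ∷ xs) l))

path-to-s¹-from-B²-splits : ∀ {i} u xs → IsPath (suc i) (inj₂ u) (inj₁ (s i)) (inj₂ u ∷ xs) →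
  ∃[ ys ] ∃[ zs ] (inj₂ u ∷ xs ≡ map inj₂ (u ∷ ys) ++ map inj₁ (t i ∷ zs)
                   × IsPath i u (s i) (u ∷ ys) × IsPath i (t i) (s i) (t i ∷ zs))
path-to-s¹-from-B²-splits u (inj₂ u′ ∷ xs) path@(inB² e ∷ _ , uniq , _)
  with path-to-s¹-from-B²-splits u′ xs (IsPath-tail path)
... | ys , zs , refl , path² , path¹ =
  u′ ∷ ys , zs , refl , IsPath-∷ e (Unique.Unique[x∷xs]⇒x∉xs uniq ∘ ∈-++⁺ˡ ∘ ∈-map⁺ inj₂) path² , path¹
path-to-s¹-from-B²-splits _ (inj₁ _ ∷ xs) path@(cross₂ ∷ _ , _) with path-to-s¹-stays-in-B¹ _ xs (IsPath-tail path)
... | zs , refl , path¹ = [] , zs , refl , ([-] , [] ∷ [] , refl , refl) , path¹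

t→s-path-unique : ∀ i p → IsPath i (t i) (s i) p → p ≡ hamiltonianPath i
t→s-path-unique zero    (tt ∷ [])     _           = refl
t→s-path-unique zero    (tt ∷ _ ∷ _) (() ∷ _ , _)
t→s-path-unique (suc i) (_ ∷ xs)     path@(_ , _ , refl , _) with path-to-s¹-from-B²-splits (t i) xs path
... | ys , zs , p≡ , path² , path¹ =
  trans p≡ (cong₂ (λ ys zs → map inj₂ ys ++ map inj₁ zs) (t→s-path-unique i _ path²) (t→s-path-unique i _ path¹))

t→s-path-spanning : ∀ {i} p → IsPath i (t i) (s i) p → ∀ v → v ∈ p
t→s-path-spanning {i} p path v = subst (v ∈_) (sym (t→s-path-unique i p path)) (∈-hamiltonianPath i v)

t¹→s²-path-spanning : ∀ {i} p → IsPath (suc i) (inj₁ (t i)) (inj₂ (s i)) p → ∀ v → v ∈ p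
t¹→s²-path-spanning p path v with ∈-map⁻ swap (t→s-path-spanning (map swap p) (IsPath-map swap swap-injective swap-hom path) (swap v))
... | w , w∈p , swap-v≡swap-w = subst (_∈ p) (sym (swap-injective swap-v≡swap-w)) w∈p

lemma8p3 : (j : ℕ) →
    ((∃[ p ] (IsPath (suc j) (t (suc j)) (s (suc j)) p × (∀ v → v ∈ p)))
      × (∀ p q → IsPath (suc j) (t (suc j)) (s (suc j)) p → IsPath (suc j) (t (suc j)) (s (suc j)) q → p ≡ q))
    × (∀ (c : List (V (suc j))) → IsCycle (suc j) c →
        (UsesEdge c (inj₁ (s j)) (inj₂ (t j)) ⊎ UsesEdge c (inj₂ (s j)) (inj₁ (t j))) →
        ∀ v → v ∈ c)
    × Circ (suc j) (2 ^ suc j)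
lemma8p3 j =
  ((H , H-path , ∈-hamiltonianPath k) ,
   (λ p q p-path q-path → trans (t→s-path-unique k p p-path) (sym (t→s-path-unique k q q-path)))) ,
  cycle-through-cross-spanning ,
  inj₁ (H , IsPath⇒IsCycle H-path cross₁ , length-hamiltonianPath k) ,
  λ c (_ , uniq , _) → subst (length c ≤_) (length-hamiltonianPath k)
                          (Unique-⊆⇒length≤ uniq (λ {v} _ → ∈-hamiltonianPath k v))
  where
  k = suc j
  H = hamiltonianPath k
  H-path = hamiltonianPath-isPath k

  cycle-through-cross-spanning : ∀ c → IsCycle k c →
    UsesEdge c (inj₁ (s j)) (inj₂ (t j)) ⊎ UsesEdge c (inj₂ (s j)) (inj₁ (t j)) → ∀ v → v ∈ c
  cycle-through-cross-spanning c cycle (inj₁ uses) v with cycle-through⇒path c cycle uses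
  ... | p , path , p↭c = ∈-resp-↭ p↭c (t→s-path-spanning p path v)
  cycle-through-cross-spanning c cycle (inj₂ uses) v with cycle-through⇒path c cycle uses
  ... | p , path , p↭c = ∈-resp-↭ p↭c (t¹→s²-path-spanning p path v)
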